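{- Let $n\ge1$, $D_n=\langle a,b\mid a^n=b^2=1,\ bab=a^{ -1}\rangle$, and $T\subseteq\langle a\rangle$. If $T\in B(\langle a\rangle)$, then $2\chi_h(T^2)=(\chi_h(T))^2$ for all $1\le h\le\lfloor\frac{n-1}{2}\rfloor$.
   Context: $\chi_h$ is the character of $D_n$ with $\chi_h(a^k)=2\cos(\frac{2kh\pi}{n})$, $\chi_h(ba^k)=0$; $\chi_h(T)=\sum_{x\in T}\chi_h(x)$ and $\chi_h(T^2)=\sum_{x,y\in T}\chi_h(xy)$ (ordered pairs). $B(\langle a\rangle)$ is the Boolean algebra of subsets of $\langle a\rangle$ generated by its subgroups under finite unions, intersections and complements; equivalently, unions of atoms $[g]=\{x\in\langle a\rangle:\langle x\rangle=\langle g\rangle\}$. -}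

module Defs where

open import Level using (Level)
open import Data.Nat using (ℕ; zero; suc; _∸_; NonZero)
import Data.Nat as ℕ
open import Data.Nat.DivMod using (_mod_)
open import Data.Fin using (Fin; toℕ)
open import Data.Fin.Subset using (Subset; _∈_; ∁; _∪_; _∩_)
open import Data.Bool using (if_then_else_)
open import Data.List using (List; foldr; allFin)
open import Data.Vec using (lookup)
open import Algebra.Bundles using (CommutativeRing; Semiring)
import Algebra.Definitions.RawSemiring as RS
open import Data.Product using (_×_)
open import Relation.Nullary using (¬_)

-- The cyclic group ⟨a⟩ ≤ D_n, with a^k represented by its exponent k : Fin n.
-- Group operation a^k · a^m = a^((k+m) mod n), inverse (a^k)⁻¹ = a^((n-k) mod n).
_⊕_ : {n : ℕ} .{{_ : NonZero n}} → Fin n → Fin n → Fin n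
_⊕_ {n} k m = (toℕ k Data.Nat.+ toℕ m) mod n

⊖_ : {n : ℕ} .{{_ : NonZero n}} → Fin n → Fin n
⊖_ {n} k = (n ∸ toℕ k) mod n

e₀ : {n : ℕ} .{{_ : NonZero n}} → Fin n
e₀ {n} = 0 mod n

record IsSubgroup {n : ℕ} .{{_ : NonZero n}} (S : Subset n) : Set where
  field
    has-e   : e₀ ∈ S
    closed⊕ : ∀ {x y} → x ∈ S → y ∈ S → (x ⊕ y) ∈ S
    closed⊖ : ∀ {x} → x ∈ S → (⊖ x) ∈ S

data InB {n : ℕ} .{{_ : NonZero n}} : Subset n → Set where
  sub   : ∀ {S} → IsSubgroup S → InB S
  compl : ∀ {S} → InB S → InB (∁ S)
  union : ∀ {S U} → InB S → InB U → InB (S ∪ U)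
  inter : ∀ {S U} → InB S → InB U → InB (S ∩ U)

module _ {c ℓ : Level} (R : CommutativeRing c ℓ) where
  open CommutativeRing R
  open RS (Semiring.rawSemiring semiring) using (_^_)

  ΣT : {n : ℕ} → Subset n → (Fin n → Carrier) → Carrier
  ΣT {n} T f = foldr (λ k acc → (if lookup T k then f k else 0#) + acc) 0# (allFin n)

  -- χ_h(a^k) = ω^(hk) + ω^(-hk)  (= 2cos(2khπ/n) when R = ℂ, ω = e^(2πi/n)),
  -- where ω^(-hk) is written ω^(h(n-k)) using ω^n = 1.
  χ : {n : ℕ} → Carrier → ℕ → Fin n → Carrier
  χ {n} ω h k = (ω ^ (h ℕ.* toℕ k)) + (ω ^ (h ℕ.* (n ∸ toℕ k)))

  χT : {n : ℕ} → Carrier → ℕ → Subset n → Carrier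
  χT ω h T = ΣT T (χ ω h)

  -- χ_h(T²) = Σ_{x,y∈T} χ_h(xy)  (ordered pairs)
  χT² : {n : ℕ} .{{_ : NonZero n}} → Carrier → ℕ → Subset n → Carrier
  χT² ω h T = ΣT T (λ x → ΣT T (λ y → χ ω h (x ⊕ y)))

  IsPrimitiveRoot : ℕ → Carrier → Set ℓ
  IsPrimitiveRoot n ω = (ω ^ n ≈ 1#) × (∀ m → 0 Data.Nat.< m → m Data.Nat.< n → ¬ (ω ^ m ≈ 1#))

-- Write ψ(a^k) = ω^(hk).  Since ω^n = 1, ψ is a homomorphism ⟨a⟩ → R, and so is
-- its pointwise inverse ψ⁻(a^k) = ω^(h(n-k)) = ψ(a^(-k)); and χ_h = ψ + ψ⁻.  For
-- a multiplicative f, summing f(xy) over T × T gives (Σ_T f)², hence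
-- χ_h(T²) = (Σ_T ψ)² + (Σ_T ψ⁻)².  Every set in B(⟨a⟩) is closed under inversion,
-- because subgroups are and complements, unions and intersections preserve this;
-- so substituting x ↦ x⁻¹ shows Σ_T ψ⁻ = Σ_T ψ =: A.  Then 2χ_h(T²) = 4A² = χ_h(T)².
module Submission where

open import Defs
open import Level using (Level)
open import Data.Nat using (ℕ; _*_; _∸_; _≤_; NonZero)
open import Data.Fin.Subset using (Subset)
open import Algebra.Bundles using (CommutativeRing)

import Data.Nat as ℕ
import Data.Nat.Properties as ℕ
open import Data.Nat.DivMod using (_mod_; _%_; _/_; m≡m%n+[m/n]*n; n%n≡0; m<n⇒m%n≡m)
open import Data.Fin using (Fin; toℕ; zero; suc)
open import Data.Fin.Properties using (toℕ-fromℕ<; toℕ-injective; toℕ<n)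
open import Data.Fin.Subset using (∁; _∪_; _∩_)
open import Data.Fin.Permutation using (Permutation′; permutation)
open import Data.Bool using (true; false; if_then_else_; not; _∨_; _∧_)
open import Data.Bool.Properties using (⇔→≡)
open import Data.List using (foldr; tabulate)
open import Data.Vec using (lookup)
open import Data.Vec.Properties using (lookup-map; lookup-zipWith; []=⇒lookup; lookup⇒[]=)
open import Function using (_∘_; mk⇔)
open import Relation.Binary.PropositionalEquality
  using (_≡_; refl; trans; cong; cong₂; subst; module ≡-Reasoning)
open import Data.Product using (_,_)
import Algebra.Properties.Semiring.Exp as Exp
import Algebra.Properties.Semiring.Sum as Sum
import Algebra.Properties.CommutativeSemigroup as CommutativeSemigroupProperties
import Relation.Binary.Reasoning.Setoid as SetoidReasoning

module _ {n : ℕ} .{{_ : NonZero n}} where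

  toℕ-mod : ∀ m → toℕ (m mod n) ≡ m % n
  toℕ-mod m = toℕ-fromℕ< _

  toℕ-⊖ : ∀ (x : Fin n) → toℕ (⊖ x) ≡ (n ∸ toℕ x) % n
  toℕ-⊖ x = toℕ-mod (n ∸ toℕ x)

  InverseClosed : Subset n → Set
  InverseClosed T = ∀ x → lookup T (⊖ x) ≡ lookup T x

⊖-involutive : ∀ {n} .{{_ : NonZero n}} (x : Fin n) → ⊖ (⊖ x) ≡ x
⊖-involutive {n@(ℕ.suc _)} zero = toℕ-injective (begin
  toℕ (⊖ (⊖ zero))             ≡⟨ toℕ-⊖ (⊖ zero) ⟩
  (n ∸ toℕ (⊖ zero)) % n       ≡⟨ cong (λ k → (n ∸ k) % n) (trans (toℕ-⊖ zero) (n%n≡0 n)) ⟩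
  n % n                        ≡⟨ n%n≡0 n ⟩
  0                            ∎)
  where open ≡-Reasoning
⊖-involutive {n@(ℕ.suc m)} (suc k) = toℕ-injective (begin
  toℕ (⊖ (⊖ suc k))            ≡⟨ toℕ-⊖ (⊖ suc k) ⟩
  (n ∸ toℕ (⊖ suc k)) % n      ≡⟨ cong (λ j → (n ∸ j) % n) (trans (toℕ-⊖ (suc k)) n∸x%n≡n∸x) ⟩
  (n ∸ (n ∸ toℕ (suc k))) % n  ≡⟨ cong (_% n) (ℕ.m∸[m∸n]≡n (ℕ.<⇒≤ (toℕ<n (suc k)))) ⟩
  toℕ (suc k) % n              ≡⟨ m<n⇒m%n≡m (toℕ<n (suc k)) ⟩
  toℕ (suc k)                  ∎)
  where
  open ≡-Reasoning
  n∸x%n≡n∸x : (n ∸ toℕ (suc k)) % n ≡ n ∸ toℕ (suc k)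
  n∸x%n≡n∸x = m<n⇒m%n≡m (ℕ.s≤s (ℕ.m∸n≤m m (toℕ k)))

⊖-permutation : ∀ {n} .{{_ : NonZero n}} → Permutation′ n
⊖-permutation = permutation ⊖_ ⊖_ ⊖-involutive ⊖-involutive

subgroup⇒inverseClosed : ∀ {n} .{{_ : NonZero n}} {S : Subset n} → IsSubgroup S → InverseClosed S
subgroup⇒inverseClosed {S = S} sg x = ⇔→≡ (mk⇔ ⊖x∈S⇒x∈S (y∈S⇒⊖y∈S x))
  where
  open IsSubgroup sg
  y∈S⇒⊖y∈S : ∀ y → lookup S y ≡ true → lookup S (⊖ y) ≡ true
  y∈S⇒⊖y∈S y = []=⇒lookup ∘ closed⊖ ∘ lookup⇒[]= y S
  ⊖x∈S⇒x∈S : lookup S (⊖ x) ≡ true → lookup S x ≡ true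
  ⊖x∈S⇒x∈S = subst (λ y → lookup S y ≡ true) (⊖-involutive x) ∘ y∈S⇒⊖y∈S (⊖ x)

InB⇒inverseClosed : ∀ {n} .{{_ : NonZero n}} {T : Subset n} → InB T → InverseClosed T
InB⇒inverseClosed (sub sg) = subgroup⇒inverseClosed sg
InB⇒inverseClosed (compl {S} p) x = begin
  lookup (∁ S) (⊖ x)    ≡⟨ lookup-map (⊖ x) not S ⟩
  not (lookup S (⊖ x))  ≡⟨ cong not (InB⇒inverseClosed p x) ⟩
  not (lookup S x)      ≡⟨ lookup-map x not S ⟨
  lookup (∁ S) x        ∎
  where open ≡-Reasoning
InB⇒inverseClosed (union {S} {U} p q) x = begin
  lookup (S ∪ U) (⊖ x)                  ≡⟨ lookup-zipWith _∨_ (⊖ x) S U ⟩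
  lookup S (⊖ x) ∨ lookup U (⊖ x)       ≡⟨ cong₂ _∨_ (InB⇒inverseClosed p x) (InB⇒inverseClosed q x) ⟩
  lookup S x ∨ lookup U x               ≡⟨ lookup-zipWith _∨_ x S U ⟨
  lookup (S ∪ U) x                      ∎
  where open ≡-Reasoning
InB⇒inverseClosed (inter {S} {U} p q) x = begin
  lookup (S ∩ U) (⊖ x)                  ≡⟨ lookup-zipWith _∧_ (⊖ x) S U ⟩
  lookup S (⊖ x) ∧ lookup U (⊖ x)       ≡⟨ cong₂ _∧_ (InB⇒inverseClosed p x) (InB⇒inverseClosed q x) ⟩
  lookup S x ∧ lookup U x               ≡⟨ lookup-zipWith _∧_ x S U ⟨
  lookup (S ∩ U) x                      ∎
  where open ≡-Reasoning

module _ {c ℓ : Level} (R : CommutativeRing c ℓ) where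
  open CommutativeRing R hiding (zero) renaming (_*_ to _·_; refl to ≈-refl; sym to ≈-sym; trans to ≈-trans)
  open Sum semiring using (sum; sum-cong-≋; sum-cong-≗; sum-permute; ∑-distrib-+; *-distribˡ-sum)
  open Exp semiring using (_^_; ^-congˡ; ^-congʳ; ^-homo-*; ^-assocʳ)
  open CommutativeSemigroupProperties *-commutativeSemigroup using (interchange; x∙yz≈y∙xz)
  open SetoidReasoning setoid

  restrict : ∀ {n} → Subset n → (Fin n → Carrier) → Fin n → Carrier
  restrict T f i = if lookup T i then f i else 0#

  foldr-tabulate : ∀ {m n} (g : Fin m → Carrier) (σ : Fin n → Fin m) →
                   foldr (λ k acc → g k + acc) 0# (tabulate σ) ≡ sum (g ∘ σ)
  foldr-tabulate {n = ℕ.zero}  g σ = refl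
  foldr-tabulate {n = ℕ.suc _} g σ = cong (g (σ zero) +_) (foldr-tabulate g (σ ∘ suc))

  ΣT≡sum : ∀ {n} (T : Subset n) f → ΣT R T f ≡ sum (restrict T f)
  ΣT≡sum T f = foldr-tabulate (restrict T f) (λ i → i)

  module _ {n : ℕ} (T : Subset n) where

    ΣT-cong : ∀ {f g} → (∀ x → f x ≈ g x) → ΣT R T f ≈ ΣT R T g
    ΣT-cong {f} {g} f≈g = begin
      ΣT R T f           ≡⟨ ΣT≡sum T f ⟩
      sum (restrict T f) ≈⟨ sum-cong-≋ (λ i → restrict-cong (lookup T i)) ⟩
      sum (restrict T g) ≡⟨ ΣT≡sum T g ⟨
      ΣT R T g           ∎
      where
      restrict-cong : ∀ {i} b → (if b then f i else 0#) ≈ (if b then g i else 0#)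
      restrict-cong true  = f≈g _
      restrict-cong false = ≈-refl

    ΣT-+ : ∀ f g → ΣT R T (λ x → f x + g x) ≈ ΣT R T f + ΣT R T g
    ΣT-+ f g = begin
      ΣT R T (λ x → f x + g x)                     ≡⟨ ΣT≡sum T _ ⟩
      sum (restrict T (λ x → f x + g x))           ≈⟨ sum-cong-≋ (λ i → restrict-+ (lookup T i)) ⟩
      sum (λ i → restrict T f i + restrict T g i)  ≈⟨ ∑-distrib-+ (restrict T f) (restrict T g) ⟩
      sum (restrict T f) + sum (restrict T g)      ≡⟨ cong₂ _+_ (ΣT≡sum T f) (ΣT≡sum T g) ⟨
      ΣT R T f + ΣT R T g                          ∎
      where
      restrict-+ : ∀ {i} b → (if b then f i + g i else 0#) ≈ (if b then f i else 0#) + (if b then g i else 0#)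
      restrict-+ true  = ≈-refl
      restrict-+ false = ≈-sym (+-identityʳ 0#)

    ΣT-*ˡ : ∀ a f → ΣT R T (λ x → a · f x) ≈ a · ΣT R T f
    ΣT-*ˡ a f = begin
      ΣT R T (λ x → a · f x)             ≡⟨ ΣT≡sum T _ ⟩
      sum (restrict T (λ x → a · f x))   ≈⟨ sum-cong-≋ (λ i → restrict-*ˡ (lookup T i)) ⟩
      sum (λ i → a · restrict T f i)     ≈⟨ *-distribˡ-sum a (restrict T f) ⟨
      a · sum (restrict T f)             ≡⟨ cong (a ·_) (ΣT≡sum T f) ⟨
      a · ΣT R T f                       ∎
      where
      restrict-*ˡ : ∀ {i} b → (if b then a · f i else 0#) ≈ a · (if b then f i else 0#)
      restrict-*ˡ true  = ≈-refl
      restrict-*ˡ false = ≈-sym (zeroʳ a)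

    ΣT-*ʳ : ∀ a f → ΣT R T (λ x → f x · a) ≈ ΣT R T f · a
    ΣT-*ʳ a f = begin
      ΣT R T (λ x → f x · a)  ≈⟨ ΣT-cong (λ x → *-comm (f x) a) ⟩
      ΣT R T (λ x → a · f x)  ≈⟨ ΣT-*ˡ a f ⟩
      a · ΣT R T f            ≈⟨ *-comm a _ ⟩
      ΣT R T f · a            ∎

    module _ .{{_ : NonZero n}} where

      ΣT-⊖ : InverseClosed T → ∀ f → ΣT R T (f ∘ ⊖_) ≈ ΣT R T f
      ΣT-⊖ closed f = begin
        ΣT R T (f ∘ ⊖_)                ≡⟨ ΣT≡sum T (f ∘ ⊖_) ⟩
        sum (restrict T (f ∘ ⊖_))      ≡⟨ sum-cong-≗ (λ i → cong (λ b → if b then f (⊖ i) else 0#) (closed i)) ⟨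
        sum (restrict T f ∘ ⊖_)        ≈⟨ sum-permute (restrict T f) ⊖-permutation ⟨
        sum (restrict T f)             ≡⟨ ΣT≡sum T f ⟨
        ΣT R T f                       ∎

      ΣT²-multiplicative : ∀ f → (∀ x y → f (x ⊕ y) ≈ f x · f y) →
                           ΣT R T (λ x → ΣT R T (λ y → f (x ⊕ y))) ≈ ΣT R T f · ΣT R T f
      ΣT²-multiplicative f f-⊕ = begin
        ΣT R T (λ x → ΣT R T (λ y → f (x ⊕ y)))  ≈⟨ ΣT-cong (λ x → ΣT-cong (f-⊕ x)) ⟩
        ΣT R T (λ x → ΣT R T (λ y → f x · f y))  ≈⟨ ΣT-cong (λ x → ΣT-*ˡ (f x) f) ⟩
        ΣT R T (λ x → f x · ΣT R T f)            ≈⟨ ΣT-*ʳ (ΣT R T f) f ⟩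
        ΣT R T f · ΣT R T f                      ∎

  ·-inverse-unique : ∀ {x y z} → y · x ≈ 1# → z · x ≈ 1# → y ≈ z
  ·-inverse-unique {x} {y} {z} yx≈1 zx≈1 = begin
    y            ≈⟨ *-identityʳ y ⟨
    y · 1#       ≈⟨ *-congˡ zx≈1 ⟨
    y · (z · x)  ≈⟨ x∙yz≈y∙xz y z x ⟩
    z · (y · x)  ≈⟨ *-congˡ yx≈1 ⟩
    z · 1#       ≈⟨ *-identityʳ z ⟩
    z            ∎

  ·-inverse-· : ∀ {x y v w} → y · x ≈ 1# → w · v ≈ 1# → (y · w) · (x · v) ≈ 1#
  ·-inverse-· {x} {y} {v} {w} yx≈1 wv≈1 = begin
    (y · w) · (x · v)  ≈⟨ interchange y w x v ⟩
    (y · x) · (w · v)  ≈⟨ *-cong yx≈1 wv≈1 ⟩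
    1# · 1#            ≈⟨ *-identityˡ 1# ⟩
    1#                 ∎

  double-square : ∀ a → (a + a) · (a + a) ≈ (a · a + a · a) + (a · a + a · a)
  double-square a = begin
    (a + a) · (a + a)                  ≈⟨ distribˡ (a + a) a a ⟩
    (a + a) · a + (a + a) · a          ≈⟨ +-cong (distribʳ a a a) (distribʳ a a a) ⟩
    (a · a + a · a) + (a · a + a · a)  ∎

  module PowerCharacters (ω : Carrier) {n : ℕ} .{{_ : NonZero n}} (ωⁿ≈1 : ω ^ n ≈ 1#) (h : ℕ) where

    ^-multiple : ∀ q → ω ^ (q * n) ≈ 1#
    ^-multiple ℕ.zero    = ≈-refl
    ^-multiple (ℕ.suc q) = begin
      ω ^ (n ℕ.+ q * n)      ≈⟨ ^-homo-* ω n (q * n) ⟩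
      ω ^ n · ω ^ (q * n)    ≈⟨ *-cong ωⁿ≈1 (^-multiple q) ⟩
      1# · 1#                ≈⟨ *-identityˡ 1# ⟩
      1#                     ∎

    ^-% : ∀ m → ω ^ (m % n) ≈ ω ^ m
    ^-% m = ≈-sym (begin
      ω ^ m                              ≡⟨ cong (ω ^_) (m≡m%n+[m/n]*n m n) ⟩
      ω ^ (m % n ℕ.+ (m / n) * n)        ≈⟨ ^-homo-* ω (m % n) ((m / n) * n) ⟩
      ω ^ (m % n) · ω ^ ((m / n) * n)    ≈⟨ *-congˡ (^-multiple (m / n)) ⟩
      ω ^ (m % n) · 1#                   ≈⟨ *-identityʳ _ ⟩
      ω ^ (m % n)                        ∎)

    ^-h*% : ∀ m → ω ^ (h * (m % n)) ≈ ω ^ (h * m)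
    ^-h*% m = begin
      ω ^ (h * (m % n))   ≈⟨ ω^[h*k]≈[ω^k]^h (m % n) ⟩
      (ω ^ (m % n)) ^ h   ≈⟨ ^-congˡ h (^-% m) ⟩
      (ω ^ m) ^ h         ≈⟨ ω^[h*k]≈[ω^k]^h m ⟨
      ω ^ (h * m)         ∎
      where
      ω^[h*k]≈[ω^k]^h : ∀ k → ω ^ (h * k) ≈ (ω ^ k) ^ h
      ω^[h*k]≈[ω^k]^h k = ≈-trans (^-congʳ ω (ℕ.*-comm h k)) (≈-sym (^-assocʳ ω k h))

    ψ ψ⁻ : Fin n → Carrier
    ψ  k = ω ^ (h * toℕ k)
    ψ⁻ k = ω ^ (h * (n ∸ toℕ k))

    ψ-⊕ : ∀ x y → ψ (x ⊕ y) ≈ ψ x · ψ y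
    ψ-⊕ x y = begin
      ω ^ (h * toℕ (x ⊕ y))                  ≡⟨ cong (λ k → ω ^ (h * k)) (toℕ-mod (toℕ x ℕ.+ toℕ y)) ⟩
      ω ^ (h * ((toℕ x ℕ.+ toℕ y) % n))      ≈⟨ ^-h*% (toℕ x ℕ.+ toℕ y) ⟩
      ω ^ (h * (toℕ x ℕ.+ toℕ y))            ≡⟨ cong (ω ^_) (ℕ.*-distribˡ-+ h (toℕ x) (toℕ y)) ⟩
      ω ^ (h * toℕ x ℕ.+ h * toℕ y)          ≈⟨ ^-homo-* ω (h * toℕ x) (h * toℕ y) ⟩
      ψ x · ψ y                              ∎

    ψ-⊖ : ∀ x → ψ (⊖ x) ≈ ψ⁻ x
    ψ-⊖ x = ≈-trans (^-congʳ ω (cong (h *_) (toℕ-⊖ x))) (^-h*% (n ∸ toℕ x))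

    ψ⁻·ψ≈1 : ∀ x → ψ⁻ x · ψ x ≈ 1#
    ψ⁻·ψ≈1 x = begin
      ω ^ (h * (n ∸ toℕ x)) · ω ^ (h * toℕ x)  ≈⟨ ^-homo-* ω (h * (n ∸ toℕ x)) (h * toℕ x) ⟨
      ω ^ (h * (n ∸ toℕ x) ℕ.+ h * toℕ x)      ≡⟨ cong (ω ^_) (ℕ.*-distribˡ-+ h (n ∸ toℕ x) (toℕ x)) ⟨
      ω ^ (h * (n ∸ toℕ x ℕ.+ toℕ x))          ≡⟨ cong (λ k → ω ^ (h * k)) (ℕ.m∸n+n≡m (ℕ.<⇒≤ (toℕ<n x))) ⟩
      ω ^ (h * n)                              ≈⟨ ^-multiple h ⟩
      1#                                       ∎

    ψ⁻-⊕ : ∀ x y → ψ⁻ (x ⊕ y) ≈ ψ⁻ x · ψ⁻ y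
    ψ⁻-⊕ x y = ·-inverse-unique
      (≈-trans (*-congˡ (≈-sym (ψ-⊕ x y))) (ψ⁻·ψ≈1 (x ⊕ y)))
      (·-inverse-· (ψ⁻·ψ≈1 x) (ψ⁻·ψ≈1 y))

    module _ (T : Subset n) where

      χT≈Σψ+Σψ⁻ : χT R ω h T ≈ ΣT R T ψ + ΣT R T ψ⁻
      χT≈Σψ+Σψ⁻ = ΣT-+ T ψ ψ⁻

      χT²≈Σψ²+Σψ⁻² : χT² R ω h T ≈ ΣT R T ψ · ΣT R T ψ + ΣT R T ψ⁻ · ΣT R T ψ⁻
      χT²≈Σψ²+Σψ⁻² = begin
        ΣT R T (λ x → ΣT R T (λ y → ψ (x ⊕ y) + ψ⁻ (x ⊕ y)))
          ≈⟨ ΣT-cong T (λ x → ΣT-+ T (λ y → ψ (x ⊕ y)) (λ y → ψ⁻ (x ⊕ y))) ⟩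
        ΣT R T (λ x → ΣT R T (λ y → ψ (x ⊕ y)) + ΣT R T (λ y → ψ⁻ (x ⊕ y)))
          ≈⟨ ΣT-+ T _ _ ⟩
        ΣT R T (λ x → ΣT R T (λ y → ψ (x ⊕ y))) + ΣT R T (λ x → ΣT R T (λ y → ψ⁻ (x ⊕ y)))
          ≈⟨ +-cong (ΣT²-multiplicative T ψ ψ-⊕) (ΣT²-multiplicative T ψ⁻ ψ⁻-⊕) ⟩
        ΣT R T ψ · ΣT R T ψ + ΣT R T ψ⁻ · ΣT R T ψ⁻
          ∎

      Σψ⁻≈Σψ : InverseClosed T → ΣT R T ψ⁻ ≈ ΣT R T ψ
      Σψ⁻≈Σψ closed = ≈-trans (ΣT-cong T (≈-sym ∘ ψ-⊖)) (ΣT-⊖ T closed ψ)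

lemma3p4 : {c ℓ : Level} (R : CommutativeRing c ℓ) (ω : CommutativeRing.Carrier R)
           (n : ℕ) .{{_ : NonZero n}} → IsPrimitiveRoot R n ω →
           (T : Subset n) → InB T →
           (h : ℕ) → 1 ≤ h → 2 * h ≤ n ∸ 1 →
           CommutativeRing._≈_ R
             (CommutativeRing._+_ R (χT² R ω h T) (χT² R ω h T))
             (CommutativeRing._*_ R (χT R ω h T) (χT R ω h T))
lemma3p4 R ω n (ωⁿ≈1 , _) T T∈B h _ _ = begin
  χT² R ω h T + χT² R ω h T          ≈⟨ +-cong χT²≈A²+A² χT²≈A²+A² ⟩
  (A · A + A · A) + (A · A + A · A)  ≈⟨ double-square R A ⟨
  (A + A) · (A + A)                  ≈⟨ *-cong χT≈A+A χT≈A+A ⟨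
  χT R ω h T · χT R ω h T            ∎
  where
  open CommutativeRing R using (Carrier; _≈_; _+_; +-cong; +-congˡ; *-cong; setoid) renaming (_*_ to _·_; trans to ≈-trans)
  open SetoidReasoning setoid
  open PowerCharacters R ω ωⁿ≈1 h
  A : Carrier
  A = ΣT R T ψ
  Σψ⁻≈A : ΣT R T ψ⁻ ≈ A
  Σψ⁻≈A = Σψ⁻≈Σψ T (InB⇒inverseClosed T∈B)
  χT≈A+A : χT R ω h T ≈ A + A
  χT≈A+A = ≈-trans (χT≈Σψ+Σψ⁻ T) (+-congˡ Σψ⁻≈A)
  χT²≈A²+A² : χT² R ω h T ≈ A · A + A · A
  χT²≈A²+A² = ≈-trans (χT²≈Σψ²+Σψ⁻² T) (+-congˡ (*-cong Σψ⁻≈A Σψ⁻≈A))
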